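{- Let $q\ge1$ and let $p,m$ be nonnegative integers. For a nonnegative integer $x$, write $$\frac{\Delta_q^{x+m}}{q^{x+m}(x+m)!}\,l^{p+x}=\sum_{a}c^p_{m,a}(x)\,l^a$$ as a polynomial in $l$. Then each coefficient $c^p_{m,a}(x)$ is polynomial in $x$ (i.e. agrees for all nonnegative integers $x$ with a polynomial in $x$), of degree $2p-a-2m$.
   Context: $\Delta_q$ is the backward difference operator acting on functions of $l$: $(\Delta_qf)(l)=f(l)-f(l-q)$. -}

module Defs where

open import Data.Nat using (ℕ; zero; suc; NonZero) renaming (_+_ to _+ℕ_; _*_ to _*ℕ_; _^_ to _^ℕ_)
open import Data.Nat.Properties using (m*n≢0; m^n≢0; _!≢0)
open import Data.Nat.Combinatorics using () 
open import Data.Nat.Base using (_!)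
open import Data.Integer using (+_)
open import Data.Rational using (ℚ; 0ℚ; 1ℚ; _+_; _*_; _-_; _/_)
open import Data.List using (List; []; _∷_; _++_; [_]; length)
open import Data.Product using (Σ; _×_)
open import Relation.Binary.PropositionalEquality using (_≡_; _≢_)
open import Function using (_∘_)

ℕtoℚ : ℕ → ℚ
ℕtoℚ n = (+ n) / 1

pow : ℚ → ℕ → ℚ
pow l zero    = 1ℚ
pow l (suc n) = l * pow l n

Δ : ℚ → (ℚ → ℚ) → (ℚ → ℚ)
Δ q f l = f l - f (l - q)

Δ^ : ℕ → ℚ → (ℚ → ℚ) → (ℚ → ℚ)
Δ^ zero    q f = f
Δ^ (suc n) q f = Δ q (Δ^ n q f)

normDiff : (q : ℕ) → .{{NonZero q}} → (p m x : ℕ) → ℚ → ℚ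
normDiff q p m x l =
  Δ^ (x +ℕ m) (ℕtoℚ q) (λ t → pow t (p +ℕ x)) l
    * _/_ (+ 1) (q ^ℕ (x +ℕ m) *ℕ (x +ℕ m) !)
         {{m*n≢0 (q ^ℕ (x +ℕ m)) ((x +ℕ m) !) {{m^n≢0 q (x +ℕ m)}} {{(x +ℕ m) !≢0}}}}

-- polynomials in one variable over ℚ as coefficient lists, constant term first
evalP : List ℚ → ℚ → ℚ
evalP []       x = 0ℚ
evalP (c ∷ cs) x = c + x * evalP cs x

HasDegree : List ℚ → ℕ → Set
HasDegree P d = Σ (List ℚ) λ cs → Σ ℚ λ c → (P ≡ cs ++ [ c ]) × (length cs ≡ d) × (c ≢ 0ℚ)

sumL : List ℚ → ℚ
sumL []       = 0ℚ
sumL (v ∷ vs) = v + sumL vs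

-- Normalising Δ_q^n l^N by q^n n! turns the Leibniz rule
--   Δ^{n+1}(t g) = (l - (n+1)q) Δ^{n+1} g + (n+1) q Δ^n g
-- into a recursion for the coefficient lists of these polynomials in l. Put n = x + m and
-- N = n + k and read the coefficient of l^a as a function of x: its forward difference in x is
-- the coefficient of l^(a-1) at (m+1, k-1) plus -(x+m+1)q times the coefficient of l^a there.
-- By induction on (k - a, a), each of these functions is a polynomial in x of degree
-- a + 2(k - a) whose leading coefficient has sign (-1)^(k-a): the two contributions have the
-- same degree and the same sign, so they cannot cancel, and antidifferencing (done in the
-- falling-factorial basis) raises the degree by one and keeps the sign. For k = p - m the
-- degree is 2p - a - 2m.
module Submission where

open import Defs
open import Data.Nat as ℕ
  using (ℕ; zero; suc; NonZero; z≤n; s≤s; _∸_; _≤?_)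
  renaming (_+_ to _+ℕ_; _*_ to _*ℕ_; _^_ to _^ℕ_; _<_ to _<ℕ_; _≤_ to _≤ℕ_)
open import Data.Nat.Base using (_!)
open import Data.Nat.Properties as ℕP using (_!≢0; m^n≢0; m*n≢0)
open import Data.Nat.Tactic.RingSolver using (solve-∀)
open import Data.Integer as ℤ using (+_)
import Data.Integer.Properties as ℤP
open import Data.Rational using (ℚ; 0ℚ; 1ℚ; _+_; _*_; _-_; -_; _/_; Positive; toℚᵘ)
open import Data.Rational.Properties as ℚP
  using (toℚᵘ-injective; toℚᵘ-fromℚᵘ; toℚᵘ-homo-+; toℚᵘ-homo-*; normalize-pos)
open import Data.Rational.Unnormalised as ℚᵘ using (mkℚᵘ; *≡*)
import Data.Rational.Unnormalised.Properties as ℚᵘP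
open import Data.Rational.Solver using (module +-*-Solver)
open import Data.List using (List; []; _∷_; [_]; map; drop; upTo; applyUpTo)
open import Data.List.Properties using (map-upTo)
open import Data.Product using (Σ; _×_; _,_; proj₁; proj₂)
open import Relation.Binary.PropositionalEquality hiding ([_])
open import Relation.Nullary using (yes; no; contradiction)

open +-*-Solver using (solve; _:+_; _:*_; _:-_; :-_; _:=_; con)

toℚᵘ-ℕtoℚ : ∀ n → toℚᵘ (ℕtoℚ n) ℚᵘ.≃ mkℚᵘ (+ n) 0
toℚᵘ-ℕtoℚ n = toℚᵘ-fromℚᵘ (mkℚᵘ (+ n) 0)

ℕtoℚ-+ : ∀ m n → ℕtoℚ (m +ℕ n) ≡ ℕtoℚ m + ℕtoℚ n
ℕtoℚ-+ m n = toℚᵘ-injective (begin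
  toℚᵘ (ℕtoℚ (m +ℕ n))             ≈⟨ toℚᵘ-ℕtoℚ (m +ℕ n) ⟩
  mkℚᵘ (+ (m +ℕ n)) 0              ≈⟨ *≡* (cong (ℤ._* + 1) numerators) ⟩
  mkℚᵘ (+ m) 0 ℚᵘ.+ mkℚᵘ (+ n) 0   ≈⟨ ℚᵘP.+-cong (toℚᵘ-ℕtoℚ m) (toℚᵘ-ℕtoℚ n) ⟨
  toℚᵘ (ℕtoℚ m) ℚᵘ.+ toℚᵘ (ℕtoℚ n) ≈⟨ toℚᵘ-homo-+ (ℕtoℚ m) (ℕtoℚ n) ⟨
  toℚᵘ (ℕtoℚ m + ℕtoℚ n)           ∎)
  where
  open ℚᵘP.≃-Reasoning
  numerators : + (m +ℕ n) ≡ + m ℤ.* + 1 ℤ.+ + n ℤ.* + 1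
  numerators = trans (ℤP.pos-+ m n)
    (sym (cong₂ ℤ._+_ (ℤP.*-identityʳ (+ m)) (ℤP.*-identityʳ (+ n))))

ℕtoℚ-* : ∀ m n → ℕtoℚ (m *ℕ n) ≡ ℕtoℚ m * ℕtoℚ n
ℕtoℚ-* m n = toℚᵘ-injective (begin
  toℚᵘ (ℕtoℚ (m *ℕ n))             ≈⟨ toℚᵘ-ℕtoℚ (m *ℕ n) ⟩
  mkℚᵘ (+ (m *ℕ n)) 0              ≈⟨ *≡* (cong (ℤ._* + 1) (ℤP.pos-* m n)) ⟩
  mkℚᵘ (+ m) 0 ℚᵘ.* mkℚᵘ (+ n) 0   ≈⟨ ℚᵘP.*-cong (toℚᵘ-ℕtoℚ m) (toℚᵘ-ℕtoℚ n) ⟨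
  toℚᵘ (ℕtoℚ m) ℚᵘ.* toℚᵘ (ℕtoℚ n) ≈⟨ toℚᵘ-homo-* (ℕtoℚ m) (ℕtoℚ n) ⟨
  toℚᵘ (ℕtoℚ m * ℕtoℚ n)           ∎)
  where open ℚᵘP.≃-Reasoning

ℕtoℚ-suc : ∀ n → ℕtoℚ (suc n) ≡ 1ℚ + ℕtoℚ n
ℕtoℚ-suc = ℕtoℚ-+ 1

ℕtoℚ-positive : ∀ n .{{_ : NonZero n}} → Positive (ℕtoℚ n)
ℕtoℚ-positive n = normalize-pos n 1

ℕtoℚ-*-recip : ∀ a {b d} .{{_ : NonZero b}} .{{_ : NonZero d}} →
  b ≡ a *ℕ d → ℕtoℚ a * (+ 1 / b) ≡ + 1 / d
ℕtoℚ-*-recip a {suc b} {suc d} b≡a*d = toℚᵘ-injective (begin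
  toℚᵘ (ℕtoℚ a * (+ 1 / suc b))         ≈⟨ toℚᵘ-homo-* (ℕtoℚ a) (+ 1 / suc b) ⟩
  toℚᵘ (ℕtoℚ a) ℚᵘ.* toℚᵘ (+ 1 / suc b) ≈⟨ ℚᵘP.*-cong (toℚᵘ-ℕtoℚ a) (toℚᵘ-fromℚᵘ (mkℚᵘ (+ 1) b)) ⟩
  mkℚᵘ (+ a) 0 ℚᵘ.* mkℚᵘ (+ 1) b        ≈⟨ *≡* crossMultiplied ⟩
  mkℚᵘ (+ 1) d                          ≈⟨ toℚᵘ-fromℚᵘ (mkℚᵘ (+ 1) d) ⟨
  toℚᵘ (+ 1 / suc d)                    ∎)
  where
  open ℚᵘP.≃-Reasoning
  -- the denominator of the product reduces to 1 + (b + 0 + 0)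
  crossMultiplied :
    (+ a ℤ.* + 1) ℤ.* + suc d ≡ + 1 ℤ.* ℚᵘ.↧ (mkℚᵘ (+ a) 0 ℚᵘ.* mkℚᵘ (+ 1) b)
  crossMultiplied =
    trans (cong (ℤ._* + suc d) (ℤP.*-identityʳ (+ a)))
      (trans (sym (ℤP.pos-* a (suc d)))
        (trans (cong +_ (sym b≡a*d))
          (cong (λ z → + suc z) (sym (trans (ℕP.+-identityʳ (b +ℕ 0)) (ℕP.+-identityʳ b))))))

ℕtoℚ-*-recip-suc : ∀ j → ℕtoℚ (suc j) * (+ 1 / suc j) ≡ 1ℚ
ℕtoℚ-*-recip-suc j = ℕtoℚ-*-recip (suc j) (sym (ℕP.*-identityʳ (suc j)))

Δ^-const : ∀ n h c l → Δ^ (suc n) h (λ _ → c) l ≡ 0ℚ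
Δ^-const zero    h c l = ℚP.+-inverseʳ c
Δ^-const (suc n) h c l rewrite Δ^-const n h c l | Δ^-const n h c (l - h) = refl

Δ^-leibniz : ∀ n h (g : ℚ → ℚ) l →
  Δ^ (suc n) h (λ t → t * g t) l
    ≡ (l - ℕtoℚ (suc n) * h) * Δ^ (suc n) h g l + ℕtoℚ (suc n) * h * Δ^ n h g l
Δ^-leibniz zero h g l =
  solve 4 (λ l h G G′ → l :* G :- (l :- h) :* G′
                       := (l :- con 1ℚ :* h) :* (G :- G′) :+ con 1ℚ :* h :* G)
    refl l h (g l) (g (l - h))
Δ^-leibniz (suc n) h g l
  rewrite Δ^-leibniz n h g l | Δ^-leibniz n h g (l - h) | ℕtoℚ-suc (suc n) =
  solve 6 (λ l h N A B B′ →
      (l :- N :* h) :* (B :- B′) :+ N :* h :* B :- ((l :- h :- N :* h) :* A :+ N :* h :* B′)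
      := (l :- (con 1ℚ :+ N) :* h) :* ((B :- B′) :- A) :+ (con 1ℚ :+ N) :* h :* (B :- B′))
    refl l h (ℕtoℚ (suc n)) (Δ^ (suc n) h g (l - h)) (Δ^ n h g l) (Δ^ n h g (l - h))

infixl 6 _⊕_

_⊕_ : List ℚ → List ℚ → List ℚ
[]      ⊕ R       = R
(p ∷ P) ⊕ []      = p ∷ P
(p ∷ P) ⊕ (r ∷ R) = (p + r) ∷ (P ⊕ R)

scale : ℚ → List ℚ → List ℚ
scale k = map (k *_)

addHead : ℚ → List ℚ → List ℚ
addHead b []      = [ b ]
addHead b (c ∷ P) = (b + c) ∷ P

linMul : ℚ → List ℚ → List ℚ
linMul c []      = []
linMul c (b ∷ P) = c * b ∷ addHead b (linMul c P)

coef : List ℚ → ℕ → ℚ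
coef []      _       = 0ℚ
coef (c ∷ P) zero    = c
coef (c ∷ P) (suc a) = coef P a

evalP-⊕ : ∀ P R y → evalP (P ⊕ R) y ≡ evalP P y + evalP R y
evalP-⊕ []      R       y = sym (ℚP.+-identityˡ _)
evalP-⊕ (p ∷ P) []      y = sym (ℚP.+-identityʳ _)
evalP-⊕ (p ∷ P) (r ∷ R) y rewrite evalP-⊕ P R y =
  solve 5 (λ p r y E F → (p :+ r) :+ y :* (E :+ F) := (p :+ y :* E) :+ (r :+ y :* F))
    refl p r y (evalP P y) (evalP R y)

evalP-addHead : ∀ b P y → evalP (addHead b P) y ≡ b + evalP P y
evalP-addHead b []      y = solve 2 (λ b y → b :+ y :* con 0ℚ := b :+ con 0ℚ) refl b y
evalP-addHead b (c ∷ P) y = ℚP.+-assoc b c _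

evalP-linMul : ∀ c P y → evalP (linMul c P) y ≡ (y + c) * evalP P y
evalP-linMul c []      y = sym (ℚP.*-zeroʳ (y + c))
evalP-linMul c (b ∷ P) y rewrite evalP-addHead b (linMul c P) y | evalP-linMul c P y =
  solve 4 (λ c b y E → c :* b :+ y :* (b :+ (y :+ c) :* E) := (y :+ c) :* (b :+ y :* E))
    refl c b y (evalP P y)

coef-⊕ : ∀ P R a → coef (P ⊕ R) a ≡ coef P a + coef R a
coef-⊕ []      R       a       = sym (ℚP.+-identityˡ _)
coef-⊕ (p ∷ P) []      zero    = sym (ℚP.+-identityʳ _)
coef-⊕ (p ∷ P) []      (suc a) = sym (ℚP.+-identityʳ _)
coef-⊕ (p ∷ P) (r ∷ R) zero    = refl
coef-⊕ (p ∷ P) (r ∷ R) (suc a) = coef-⊕ P R a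

coef-addHead-zero : ∀ b P → coef (addHead b P) zero ≡ b + coef P zero
coef-addHead-zero b []      = sym (ℚP.+-identityʳ b)
coef-addHead-zero b (c ∷ P) = refl

coef-addHead-suc : ∀ b P a → coef (addHead b P) (suc a) ≡ coef P (suc a)
coef-addHead-suc b []      a = refl
coef-addHead-suc b (c ∷ P) a = refl

coef-linMul-zero : ∀ c P → coef (linMul c P) zero ≡ c * coef P zero
coef-linMul-zero c []      = sym (ℚP.*-zeroʳ c)
coef-linMul-zero c (b ∷ P) = refl

coef-linMul-suc : ∀ c P a → coef (linMul c P) (suc a) ≡ coef P a + c * coef P (suc a)
coef-linMul-suc c []      a       = solve 1 (λ c → con 0ℚ := con 0ℚ :+ c :* con 0ℚ) refl c
coef-linMul-suc c (b ∷ P) zero    =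
  trans (coef-addHead-zero b (linMul c P)) (cong (λ z → b + z) (coef-linMul-zero c P))
coef-linMul-suc c (b ∷ P) (suc a) =
  trans (coef-addHead-suc b (linMul c P) a) (coef-linMul-suc c P a)

evalP-drop-suc : ∀ P l → evalP P l ≡ coef P zero + l * evalP (drop 1 P) l
evalP-drop-suc []      l = solve 1 (λ l → con 0ℚ := con 0ℚ :+ l :* con 0ℚ) refl l
evalP-drop-suc (c ∷ P) l = refl

coef-drop-suc : ∀ P a → coef P (suc a) ≡ coef (drop 1 P) a
coef-drop-suc []      a = refl
coef-drop-suc (c ∷ P) a = refl

evalP-vanishing : ∀ P l → (∀ a → coef P a ≡ 0ℚ) → evalP P l ≡ 0ℚ
evalP-vanishing []      l P≗0 = refl
evalP-vanishing (c ∷ P) l P≗0 rewrite P≗0 0 | evalP-vanishing P l (λ a → P≗0 (suc a)) =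
  solve 1 (λ l → con 0ℚ :+ l :* con 0ℚ := con 0ℚ) refl l

sumL-factor : ∀ M (u v : ℕ → ℚ) l →
  sumL (applyUpTo (λ a → u a * (l * v a)) M) ≡ l * sumL (applyUpTo (λ a → u a * v a) M)
sumL-factor zero    u v l = sym (ℚP.*-zeroʳ l)
sumL-factor (suc M) u v l rewrite sumL-factor M (λ a → u (suc a)) (λ a → v (suc a)) l =
  solve 4 (λ u v l S → u :* (l :* v) :+ l :* S := l :* (u :* v :+ S)) refl (u 0) (v 0) l _

evalP-sum : ∀ M P (f : ℕ → ℚ) l →
  (∀ a → a <ℕ M → f a ≡ coef P a) → (∀ a → M ≤ℕ a → coef P a ≡ 0ℚ) →
  evalP P l ≡ sumL (applyUpTo (λ a → f a * pow l a) M)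
evalP-sum zero    P f l agree vanish = evalP-vanishing P l (λ a → vanish a z≤n)
evalP-sum (suc M) P f l agree vanish = begin
  evalP P l
    ≡⟨ evalP-drop-suc P l ⟩
  coef P zero + l * evalP (drop 1 P) l
    ≡⟨ cong₂ (λ u w → u + l * w) (sym (agree 0 (s≤s z≤n)))
             (evalP-sum M (drop 1 P) (λ a → f (suc a)) l agree′ vanish′) ⟩
  f 0 + l * sumL (applyUpTo (λ a → f (suc a) * pow l a) M)
    ≡⟨ cong₂ _+_ (ℚP.*-identityʳ (f 0)) (sumL-factor M (λ a → f (suc a)) (pow l) l) ⟨
  sumL (applyUpTo (λ a → f a * pow l a) (suc M))
    ∎
  where
  open ≡-Reasoning
  agree′ : ∀ a → a <ℕ M → f (suc a) ≡ coef (drop 1 P) a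
  agree′ a a<M = trans (agree (suc a) (s≤s a<M)) (coef-drop-suc P a)
  vanish′ : ∀ a → M ≤ℕ a → coef (drop 1 P) a ≡ 0ℚ
  vanish′ a M≤a = trans (sym (coef-drop-suc P a)) (vanish (suc a) (s≤s M≤a))

^*!≢0 : ∀ q .{{_ : NonZero q}} n → NonZero (q ^ℕ n *ℕ n !)
^*!≢0 q n = m*n≢0 (q ^ℕ n) (n !) {{m^n≢0 q n}} {{n !≢0}}

normalizer : (q : ℕ) → .{{NonZero q}} → ℕ → ℚ
normalizer q n = _/_ (+ 1) (q ^ℕ n *ℕ n !) {{^*!≢0 q n}}

normalizer-suc : ∀ q .{{_ : NonZero q}} n →
  ℕtoℚ (suc n) * ℕtoℚ q * normalizer q (suc n) ≡ normalizer q n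
normalizer-suc q n = begin
  ℕtoℚ (suc n) * ℕtoℚ q * normalizer q (suc n)
    ≡⟨ cong (_* normalizer q (suc n)) (ℕtoℚ-* (suc n) q) ⟨
  ℕtoℚ (suc n *ℕ q) * normalizer q (suc n)
    ≡⟨ ℕtoℚ-*-recip (suc n *ℕ q) {{^*!≢0 q (suc n)}} {{^*!≢0 q n}}
                    (regroup q (q ^ℕ n) n (n !)) ⟩
  normalizer q n
    ∎
  where
  open ≡-Reasoning
  regroup : ∀ q Q n F → q *ℕ Q *ℕ (suc n *ℕ F) ≡ suc n *ℕ q *ℕ (Q *ℕ F)
  regroup = solve-∀

-- The coefficients of Δ_h^n l^N / (h^n n!), constant first, following Δ^-leibniz.
diffPoly : ℚ → ℕ → ℕ → List ℚ
diffPoly h zero    zero    = [ 1ℚ ]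
diffPoly h zero    (suc N) = 0ℚ ∷ diffPoly h zero N
diffPoly h (suc n) zero    = []
diffPoly h (suc n) (suc N) = linMul (- (ℕtoℚ (suc n) * h)) (diffPoly h (suc n) N) ⊕ diffPoly h n N

evalP-diffPoly-zero : ∀ h N l → evalP (diffPoly h zero N) l ≡ pow l N
evalP-diffPoly-zero h zero    l = solve 1 (λ l → con 1ℚ :+ l :* con 0ℚ := con 1ℚ) refl l
evalP-diffPoly-zero h (suc N) l rewrite evalP-diffPoly-zero h N l = ℚP.+-identityˡ _

evalP-diffPoly : ∀ q .{{_ : NonZero q}} n N l →
  Δ^ n (ℕtoℚ q) (λ t → pow t N) l * normalizer q n ≡ evalP (diffPoly (ℕtoℚ q) n N) l
evalP-diffPoly q zero    N       l = trans (ℚP.*-identityʳ _) (sym (evalP-diffPoly-zero (ℕtoℚ q) N l))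
evalP-diffPoly q (suc n) zero    l rewrite Δ^-const n (ℕtoℚ q) 1ℚ l =
  ℚP.*-zeroˡ (normalizer q (suc n))
evalP-diffPoly q (suc n) (suc N) l = begin
  Δ^ (suc n) Q (λ t → t * pow t N) l * ν (suc n)
    ≡⟨ cong (_* ν (suc n)) (Δ^-leibniz n Q (λ t → pow t N) l) ⟩
  ((l - M * Q) * A + M * Q * B) * ν (suc n)
    ≡⟨ regroup l M Q A B (ν (suc n)) ⟩
  (l - M * Q) * (A * ν (suc n)) + B * (M * Q * ν (suc n))
    ≡⟨ cong₂ (λ u w → (l - M * Q) * u + B * w) (evalP-diffPoly q (suc n) N l) (normalizer-suc q n) ⟩
  (l - M * Q) * evalP P l + B * ν n
    ≡⟨ cong (λ z → (l - M * Q) * evalP P l + z) (evalP-diffPoly q n N l) ⟩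
  (l - M * Q) * evalP P l + evalP R l
    ≡⟨ cong (_+ evalP R l) (evalP-linMul (- (M * Q)) P l) ⟨
  evalP (linMul (- (M * Q)) P) l + evalP R l
    ≡⟨ evalP-⊕ (linMul (- (M * Q)) P) R l ⟨
  evalP (diffPoly Q (suc n) (suc N)) l
    ∎
  where
  open ≡-Reasoning
  Q = ℕtoℚ q
  M = ℕtoℚ (suc n)
  ν = normalizer q
  A = Δ^ (suc n) Q (λ t → pow t N) l
  B = Δ^ n Q (λ t → pow t N) l
  P = diffPoly Q (suc n) N
  R = diffPoly Q n N
  regroup : ∀ l M Q A B v →
    ((l - M * Q) * A + M * Q * B) * v ≡ (l - M * Q) * (A * v) + B * (M * Q * v)
  regroup = solve 6 (λ l M Q A B v → ((l :- M :* Q) :* A :+ M :* Q :* B) :* v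
                                    := (l :- M :* Q) :* (A :* v) :+ B :* (M :* Q :* v)) refl

coef-diffPoly-vanish : ∀ h n N a → N <ℕ a +ℕ n → coef (diffPoly h n N) a ≡ 0ℚ
coef-diffPoly-vanish h zero    zero    (suc a) _         = refl
coef-diffPoly-vanish h zero    (suc N) (suc a) (s≤s N<a) = coef-diffPoly-vanish h zero N a N<a
coef-diffPoly-vanish h (suc n) zero    a       _         = refl
coef-diffPoly-vanish h (suc n) (suc N) zero    (s≤s N<n)
  rewrite coef-⊕ (linMul (- (ℕtoℚ (suc n) * h)) (diffPoly h (suc n) N)) (diffPoly h n N) zero
        | coef-linMul-zero (- (ℕtoℚ (suc n) * h)) (diffPoly h (suc n) N)
        | coef-diffPoly-vanish h (suc n) N zero (ℕP.m<n⇒m<1+n N<n)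
        | coef-diffPoly-vanish h n N zero N<n
  = solve 1 (λ k → k :* con 0ℚ :+ con 0ℚ := con 0ℚ) refl (- (ℕtoℚ (suc n) * h))
coef-diffPoly-vanish h (suc n) (suc N) (suc a) (s≤s N<a+1+n)
  rewrite coef-⊕ (linMul (- (ℕtoℚ (suc n) * h)) (diffPoly h (suc n) N)) (diffPoly h n N) (suc a)
        | coef-linMul-suc (- (ℕtoℚ (suc n) * h)) (diffPoly h (suc n) N) a
        | coef-diffPoly-vanish h (suc n) N a N<a+1+n
        | coef-diffPoly-vanish h (suc n) N (suc a) (ℕP.m<n⇒m<1+n N<a+1+n)
        | coef-diffPoly-vanish h n N (suc a) (subst (N <ℕ_) (ℕP.+-suc a n) N<a+1+n)
  = solve 1 (λ k → con 0ℚ :+ k :* con 0ℚ :+ con 0ℚ := con 0ℚ) refl (- (ℕtoℚ (suc n) * h))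

coef-diffPoly-diag : ∀ h n → coef (diffPoly h n n) zero ≡ 1ℚ
coef-diffPoly-diag h zero = refl
coef-diffPoly-diag h (suc n)
  rewrite coef-⊕ (linMul (- (ℕtoℚ (suc n) * h)) (diffPoly h (suc n) n)) (diffPoly h n n) zero
        | coef-linMul-zero (- (ℕtoℚ (suc n) * h)) (diffPoly h (suc n) n)
        | coef-diffPoly-vanish h (suc n) n zero (ℕP.n<1+n n)
        | coef-diffPoly-diag h n
  = solve 1 (λ k → k :* con 0ℚ :+ con 1ℚ := con 1ℚ) refl (- (ℕtoℚ (suc n) * h))

fallingFactorial : ℚ → ℕ → ℚ
fallingFactorial y zero    = 1ℚ
fallingFactorial y (suc j) = fallingFactorial y j * (y - ℕtoℚ j)

evalNewton : ℕ → List ℚ → ℚ → ℚ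
evalNewton j []      y = 0ℚ
evalNewton j (b ∷ B) y = b * fallingFactorial y j + evalNewton (suc j) B y

fallingFactorial-Δ : ∀ y j →
  fallingFactorial (1ℚ + y) (suc j) ≡ fallingFactorial y (suc j) + ℕtoℚ (suc j) * fallingFactorial y j
fallingFactorial-Δ y zero =
  solve 1 (λ y → con 1ℚ :* ((con 1ℚ :+ y) :- con 0ℚ)
                 := con 1ℚ :* (y :- con 0ℚ) :+ con 1ℚ :* con 1ℚ)
    refl y
fallingFactorial-Δ y (suc j)
  rewrite fallingFactorial-Δ y j | ℕtoℚ-suc (suc j) | ℕtoℚ-suc j =
  solve 3 (λ F y N → (F :* (y :- N) :+ (con 1ℚ :+ N) :* F) :* ((con 1ℚ :+ y) :- (con 1ℚ :+ N))
                     := F :* (y :- N) :* (y :- (con 1ℚ :+ N))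
                        :+ (con 1ℚ :+ (con 1ℚ :+ N)) :* (F :* (y :- N)))
    refl (fallingFactorial y j) y (ℕtoℚ j)

fallingFactorial-zero : ∀ j → fallingFactorial 0ℚ (suc j) ≡ 0ℚ
fallingFactorial-zero zero    = refl
fallingFactorial-zero (suc j) rewrite fallingFactorial-zero j = ℚP.*-zeroˡ (0ℚ - ℕtoℚ (suc j))

evalNewton-zero : ∀ j B → evalNewton (suc j) B 0ℚ ≡ 0ℚ
evalNewton-zero j []      = refl
evalNewton-zero j (b ∷ B) rewrite fallingFactorial-zero j | evalNewton-zero (suc j) B =
  solve 1 (λ b → b :* con 0ℚ :+ con 0ℚ := con 0ℚ) refl b

evalNewton-⊕ : ∀ j P R y → evalNewton j (P ⊕ R) y ≡ evalNewton j P y + evalNewton j R y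
evalNewton-⊕ j []      R       y = sym (ℚP.+-identityˡ _)
evalNewton-⊕ j (p ∷ P) []      y = sym (ℚP.+-identityʳ _)
evalNewton-⊕ j (p ∷ P) (r ∷ R) y rewrite evalNewton-⊕ (suc j) P R y =
  solve 5 (λ p r F E E′ → (p :+ r) :* F :+ (E :+ E′) := (p :* F :+ E) :+ (r :* F :+ E′))
    refl p r (fallingFactorial y j) (evalNewton (suc j) P y) (evalNewton (suc j) R y)

evalNewton-scale : ∀ j k P y → evalNewton j (scale k P) y ≡ k * evalNewton j P y
evalNewton-scale j k []      y = sym (ℚP.*-zeroʳ k)
evalNewton-scale j k (p ∷ P) y rewrite evalNewton-scale (suc j) k P y =
  solve 4 (λ k p F E → k :* p :* F :+ k :* E := k :* (p :* F :+ E))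
    refl k p (fallingFactorial y j) (evalNewton (suc j) P y)

evalNewton-addHead : ∀ j b P y →
  evalNewton j (addHead b P) y ≡ b * fallingFactorial y j + evalNewton j P y
evalNewton-addHead j b []      y = refl
evalNewton-addHead j b (c ∷ P) y =
  solve 4 (λ b c F E → (b :+ c) :* F :+ E := b :* F :+ (c :* F :+ E))
    refl b c (fallingFactorial y j) (evalNewton (suc j) P y)

-- From y · (y)ⱼ = (y)ⱼ₊₁ + j · (y)ⱼ for the falling factorial (y)ⱼ.
newtonLinMul : ℕ → ℚ → List ℚ → List ℚ
newtonLinMul j c []      = []
newtonLinMul j c (b ∷ B) = (ℕtoℚ j + c) * b ∷ addHead b (newtonLinMul (suc j) c B)

evalNewton-newtonLinMul : ∀ j c B y →
  evalNewton j (newtonLinMul j c B) y ≡ (y + c) * evalNewton j B y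
evalNewton-newtonLinMul j c []      y = sym (ℚP.*-zeroʳ (y + c))
evalNewton-newtonLinMul j c (b ∷ B) y
  rewrite evalNewton-addHead (suc j) b (newtonLinMul (suc j) c B) y
        | evalNewton-newtonLinMul (suc j) c B y =
  solve 6 (λ N c b F y E → (N :+ c) :* b :* F :+ (b :* (F :* (y :- N)) :+ (y :+ c) :* E)
                           := (y :+ c) :* (b :* F :+ E))
    refl (ℕtoℚ j) c b (fallingFactorial y j) y (evalNewton (suc j) B y)

antidifference : ℕ → List ℚ → List ℚ
antidifference j []      = []
antidifference j (b ∷ B) = (+ 1 / suc j) * b ∷ antidifference (suc j) B

antidifference-Δ : ∀ j B y →
  evalNewton (suc j) (antidifference j B) (1ℚ + y)
    ≡ evalNewton (suc j) (antidifference j B) y + evalNewton j B y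
antidifference-Δ j []      y = refl
antidifference-Δ j (b ∷ B) y
  rewrite fallingFactorial-Δ y j | antidifference-Δ (suc j) B y = begin
  i * b * (F′ + N * F) + (X + Y)
    ≡⟨ regroup i b F′ N F X Y ⟩
  (i * b * F′ + X) + (b * (N * i) * F + Y)
    ≡⟨ cong (λ z → (i * b * F′ + X) + (b * z * F + Y)) (ℕtoℚ-*-recip-suc j) ⟩
  (i * b * F′ + X) + (b * 1ℚ * F + Y)
    ≡⟨ cong (λ z → (i * b * F′ + X) + (z * F + Y)) (ℚP.*-identityʳ b) ⟩
  (i * b * F′ + X) + (b * F + Y)
    ∎
  where
  open ≡-Reasoning
  i  = + 1 / suc j
  N  = ℕtoℚ (suc j)
  F  = fallingFactorial y j
  F′ = fallingFactorial y (suc j)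
  X  = evalNewton (suc (suc j)) (antidifference (suc j) B) y
  Y  = evalNewton (suc j) B y
  regroup : ∀ i b F′ N F X Y →
    i * b * (F′ + N * F) + (X + Y) ≡ (i * b * F′ + X) + (b * (N * i) * F + Y)
  regroup = solve 7 (λ i b F′ N F X Y → i :* b :* (F′ :+ N :* F) :+ (X :+ Y)
                                       := (i :* b :* F′ :+ X) :+ (b :* (N :* i) :* F :+ Y)) refl

evalNewton-fromDifferences : (f : ℕ → ℚ) (B : List ℚ) →
  (∀ x → f (suc x) ≡ f x + evalNewton 0 B (ℕtoℚ x)) →
  ∀ x → f x ≡ evalNewton 0 (f 0 ∷ antidifference 0 B) (ℕtoℚ x)
evalNewton-fromDifferences f B step zero rewrite evalNewton-zero 0 (antidifference 0 B) =
  solve 1 (λ a → a := a :* con 1ℚ :+ con 0ℚ) refl (f 0)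
evalNewton-fromDifferences f B step (suc x)
  rewrite step x | evalNewton-fromDifferences f B step x | ℕtoℚ-suc x
        | antidifference-Δ 0 B (ℕtoℚ x) =
  ℚP.+-assoc (f 0 * 1ℚ) (evalNewton 1 (antidifference 0 B) (ℕtoℚ x)) (evalNewton 0 B (ℕtoℚ x))

toMonomial : ℕ → List ℚ → List ℚ
toMonomial j []      = []
toMonomial j (b ∷ B) = addHead b (linMul (- ℕtoℚ j) (toMonomial (suc j) B))

evalNewton-toMonomial : ∀ j B y →
  evalNewton j B y ≡ fallingFactorial y j * evalP (toMonomial j B) y
evalNewton-toMonomial j []      y = sym (ℚP.*-zeroʳ (fallingFactorial y j))
evalNewton-toMonomial j (b ∷ B) y
  rewrite evalNewton-toMonomial (suc j) B y
        | evalP-addHead b (linMul (- ℕtoℚ j) (toMonomial (suc j) B)) y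
        | evalP-linMul (- ℕtoℚ j) (toMonomial (suc j) B) y =
  solve 5 (λ b F y N T → b :* F :+ F :* (y :- N) :* T := F :* (b :+ (y :+ :- N) :* T))
    refl b (fallingFactorial y j) y (ℕtoℚ j) (evalP (toMonomial (suc j) B) y)

data Leading : List ℚ → ℕ → ℚ → Set where
  lead : ∀ e → Leading [ e ] zero e
  _∷ₗ_ : ∀ b {P d e} → Leading P d e → Leading (b ∷ P) (suc d) e

Leading-⊕ : ∀ {P R d e e′} → Leading P d e → Leading R d e′ → Leading (P ⊕ R) d (e + e′)
Leading-⊕ (lead e) (lead e′) = lead (e + e′)
Leading-⊕ (p ∷ₗ L) (r ∷ₗ L′) = (p + r) ∷ₗ Leading-⊕ L L′

Leading-scale : ∀ k {P d e} → Leading P d e → Leading (scale k P) d (k * e)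
Leading-scale k (lead e) = lead (k * e)
Leading-scale k (p ∷ₗ L) = (k * p) ∷ₗ Leading-scale k L

Leading-addHead : ∀ b {P d e} → Leading P (suc d) e → Leading (addHead b P) (suc d) e
Leading-addHead b (c ∷ₗ L) = (b + c) ∷ₗ L

Leading-linMul : ∀ c {P d e} → Leading P d e → Leading (linMul c P) (suc d) e
Leading-linMul c (lead e) = (c * e) ∷ₗ lead e
Leading-linMul c (b ∷ₗ L) = (c * b) ∷ₗ Leading-addHead b (Leading-linMul c L)

Leading-newtonLinMul : ∀ j c {B d e} → Leading B d e → Leading (newtonLinMul j c B) (suc d) e
Leading-newtonLinMul j c (lead e) = ((ℕtoℚ j + c) * e) ∷ₗ lead e
Leading-newtonLinMul j c (b ∷ₗ L) =
  ((ℕtoℚ j + c) * b) ∷ₗ Leading-addHead b (Leading-newtonLinMul (suc j) c L)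

Leading-antidifference : ∀ j {B d e} → Leading B d e →
  Σ ℚ λ k → Positive k × Leading (antidifference j B) d (k * e)
Leading-antidifference j (lead e) = + 1 / suc j , normalize-pos 1 (suc j) , lead _
Leading-antidifference j (b ∷ₗ L) with Leading-antidifference (suc j) L
... | k , k>0 , L′ = k , k>0 , _ ∷ₗ L′

Leading-toMonomial : ∀ j {B d e} → Leading B d e → Leading (toMonomial j B) d e
Leading-toMonomial j (lead e) = lead e
Leading-toMonomial j (b ∷ₗ L) =
  Leading-addHead b (Leading-linMul (- ℕtoℚ j) (Leading-toMonomial (suc j) L))

Leading⇒HasDegree : ∀ {P d e} → Leading P d e → e ≢ 0ℚ → HasDegree P d
Leading⇒HasDegree (lead e) e≢0 = [] , e , refl , refl , e≢0
Leading⇒HasDegree (b ∷ₗ L) e≢0 with Leading⇒HasDegree L e≢0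
... | cs , e , P≡cs++e , ∣cs∣≡d , e≢0′ =
  b ∷ cs , e , cong (b ∷_) P≡cs++e , cong suc ∣cs∣≡d , e≢0′

-- Signed s e means that (-1)^s · e is positive.
Signed : ℕ → ℚ → Set
Signed zero    e = Positive e
Signed (suc s) e = Signed s (- e)

Signed-+ : ∀ s {a b} → Signed s a → Signed s b → Signed s (a + b)
Signed-+ zero    {a} {b} a>0 b>0 = ℚP.pos+pos⇒pos a {{a>0}} b {{b>0}}
Signed-+ (suc s) {a} {b} sa sb =
  subst (Signed s) (sym (ℚP.neg-distrib-+ a b)) (Signed-+ s {(- a)} {(- b)} sa sb)

Signed-*ˡ : ∀ s {k a} → Positive k → Signed s a → Signed s (k * a)
Signed-*ˡ zero    {k} {a} k>0 a>0 = ℚP.pos*pos⇒pos k {{k>0}} a {{a>0}}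
Signed-*ˡ (suc s) {k} {a} k>0 sa =
  subst (Signed s) (sym (ℚP.neg-distribʳ-* k a)) (Signed-*ˡ s {k} {(- a)} k>0 sa)

Signed-neg-* : ∀ s {k a} → Positive k → Signed s a → Signed (suc s) ((- k) * a)
Signed-neg-* s {k} {a} k>0 sa =
  subst (Signed s) (solve 2 (λ k a → k :* a := :- ((:- k) :* a)) refl k a)
    (Signed-*ˡ s {k} {a} k>0 sa)

Signed⇒≢0 : ∀ s {a} → Signed s a → a ≢ 0ℚ
Signed⇒≢0 zero    () refl
Signed⇒≢0 (suc s) sa a≡0 = Signed⇒≢0 s sa (cong -_ a≡0)

record PolyFun (d s : ℕ) (f : ℕ → ℚ) : Set where
  field
    coeffs    : List ℚ
    leadCoeff : ℚ
    leading   : Leading coeffs d leadCoeff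
    signed    : Signed s leadCoeff
    agrees    : ∀ x → f x ≡ evalNewton 0 coeffs (ℕtoℚ x)

open PolyFun

PolyFun-one : PolyFun 0 0 (λ _ → 1ℚ)
PolyFun-one = record
  { coeffs = [ 1ℚ ] ; leadCoeff = 1ℚ ; leading = lead 1ℚ ; signed = _ ; agrees = λ _ → refl }

PolyFun-cong : ∀ {d s f g} → (∀ x → f x ≡ g x) → PolyFun d s g → PolyFun d s f
PolyFun-cong f≗g G = record
  { coeffs = coeffs G ; leadCoeff = leadCoeff G ; leading = leading G ; signed = signed G
  ; agrees = λ x → trans (f≗g x) (agrees G x) }

PolyFun-+ : ∀ {d s f g} → PolyFun d s f → PolyFun d s g → PolyFun d s (λ x → f x + g x)
PolyFun-+ {s = s} F G = record
  { coeffs    = coeffs F ⊕ coeffs G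
  ; leadCoeff = leadCoeff F + leadCoeff G
  ; leading   = Leading-⊕ (leading F) (leading G)
  ; signed    = Signed-+ s (signed F) (signed G)
  ; agrees    = λ x → trans (cong₂ _+_ (agrees F x) (agrees G x))
                            (sym (evalNewton-⊕ 0 (coeffs F) (coeffs G) (ℕtoℚ x)))
  }

PolyFun-linear : ∀ {d s g} h → Positive h → ∀ m → PolyFun d s g →
  PolyFun (suc d) (suc s) (λ x → - (ℕtoℚ (suc x +ℕ m) * h) * g x)
PolyFun-linear {s = s} {g} h h>0 m G = record
  { coeffs    = P
  ; leadCoeff = (- h) * leadCoeff G
  ; leading   = Leading-scale (- h) (Leading-newtonLinMul 0 c (leading G))
  ; signed    = Signed-neg-* s {h} h>0 (signed G)
  ; agrees    = agrees′
  }
  where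
  c = ℕtoℚ (suc m)
  P = scale (- h) (newtonLinMul 0 c (coeffs G))
  agrees′ : ∀ x → - (ℕtoℚ (suc x +ℕ m) * h) * g x ≡ evalNewton 0 P (ℕtoℚ x)
  agrees′ x = begin
    - (ℕtoℚ (suc x +ℕ m) * h) * g x
      ≡⟨ cong₂ (λ n v → - (n * h) * v) n≡x+c (agrees G x) ⟩
    - ((y + c) * h) * E
      ≡⟨ solve 4 (λ y c h E → (:- ((y :+ c) :* h)) :* E := (:- h) :* ((y :+ c) :* E)) refl y c h E ⟩
    (- h) * ((y + c) * E)
      ≡⟨ cong ((- h) *_) (evalNewton-newtonLinMul 0 c (coeffs G) y) ⟨
    (- h) * evalNewton 0 (newtonLinMul 0 c (coeffs G)) y
      ≡⟨ evalNewton-scale 0 (- h) (newtonLinMul 0 c (coeffs G)) y ⟨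
    evalNewton 0 P y
      ∎
    where
    open ≡-Reasoning
    y = ℕtoℚ x
    E = evalNewton 0 (coeffs G) y
    n≡x+c : ℕtoℚ (suc x +ℕ m) ≡ y + c
    n≡x+c = trans (cong ℕtoℚ (sym (ℕP.+-suc x m))) (ℕtoℚ-+ x (suc m))

PolyFun-antidiff : ∀ {d s f g} →
  PolyFun d s g → (∀ x → f (suc x) ≡ f x + g x) → PolyFun (suc d) s f
PolyFun-antidiff {s = s} {f} G step with Leading-antidifference 0 (leading G)
... | k , k>0 , L = record
  { coeffs    = f 0 ∷ antidifference 0 (coeffs G)
  ; leadCoeff = k * leadCoeff G
  ; leading   = f 0 ∷ₗ L
  ; signed    = Signed-*ˡ s {k} {leadCoeff G} k>0 (signed G)
  ; agrees    = evalNewton-fromDifferences f (coeffs G)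
                  (λ x → trans (step x) (cong (λ z → f x + z) (agrees G x)))
  }

PolyFun⇒polynomial : ∀ {d s f} → PolyFun d s f →
  Σ (List ℚ) λ P → HasDegree P d × (∀ x → f x ≡ evalP P (ℕtoℚ x))
PolyFun⇒polynomial {s = s} F =
  toMonomial 0 (coeffs F) ,
  Leading⇒HasDegree (Leading-toMonomial 0 (leading F)) (Signed⇒≢0 s (signed F)) ,
  λ x → trans (agrees F x) (trans (evalNewton-toMonomial 0 (coeffs F) (ℕtoℚ x)) (ℚP.*-identityˡ _))

-- coefSeq (ℕtoℚ q) m (p ∸ m) a is the paper's c^p_{m,a}, for m ≤ p.
coefSeq : ℚ → (m k a : ℕ) → ℕ → ℚ
coefSeq h m k a x = coef (diffPoly h (x +ℕ m) (x +ℕ m +ℕ k)) a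

coefSeq-suc : ∀ h m k a x →
  coefSeq h m (suc k) a (suc x)
    ≡ coefSeq h m (suc k) a x
      + coef (linMul (- (ℕtoℚ (suc x +ℕ m) * h)) (diffPoly h (x +ℕ suc m) (x +ℕ suc m +ℕ k))) a
coefSeq-suc h m k a x = begin
  coefSeq h m (suc k) a (suc x)
    ≡⟨ coef-⊕ (linMul κ P) (diffPoly h n (n +ℕ suc k)) a ⟩
  coef (linMul κ P) a + coefSeq h m (suc k) a x
    ≡⟨ ℚP.+-comm (coef (linMul κ P) a) (coefSeq h m (suc k) a x) ⟩
  coefSeq h m (suc k) a x + coef (linMul κ P) a
    ≡⟨ cong (λ P → coefSeq h m (suc k) a x + coef (linMul κ P) a) shift ⟩
  coefSeq h m (suc k) a x + coef (linMul κ (diffPoly h (x +ℕ suc m) (x +ℕ suc m +ℕ k))) a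
    ∎
  where
  open ≡-Reasoning
  n = x +ℕ m
  κ = - (ℕtoℚ (suc n) * h)
  P = diffPoly h (suc n) (n +ℕ suc k)
  shift : P ≡ diffPoly h (x +ℕ suc m) (x +ℕ suc m +ℕ k)
  shift = cong₂ (diffPoly h) (sym (ℕP.+-suc x m))
            (trans (ℕP.+-suc n k) (cong (_+ℕ k) (sym (ℕP.+-suc x m))))

coefSeq-suc-zero : ∀ h m k x →
  coefSeq h m (suc k) zero (suc x)
    ≡ coefSeq h m (suc k) zero x + - (ℕtoℚ (suc x +ℕ m) * h) * coefSeq h (suc m) k zero x
coefSeq-suc-zero h m k x = trans (coefSeq-suc h m k zero x)
  (cong (λ z → coefSeq h m (suc k) zero x + z)
        (coef-linMul-zero _ (diffPoly h (x +ℕ suc m) (x +ℕ suc m +ℕ k))))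

coefSeq-suc-suc : ∀ h m k a x →
  coefSeq h m (suc k) (suc a) (suc x)
    ≡ coefSeq h m (suc k) (suc a) x
      + (coefSeq h (suc m) k a x + - (ℕtoℚ (suc x +ℕ m) * h) * coefSeq h (suc m) k (suc a) x)
coefSeq-suc-suc h m k a x = trans (coefSeq-suc h m k (suc a) x)
  (cong (λ z → coefSeq h m (suc k) (suc a) x + z)
        (coef-linMul-suc _ (diffPoly h (x +ℕ suc m) (x +ℕ suc m +ℕ k)) a))

coefSeq-vanish : ∀ h m k a x → k <ℕ a → coefSeq h m k a x ≡ 0ℚ
coefSeq-vanish h m k a x k<a = coef-diffPoly-vanish h (x +ℕ m) (x +ℕ m +ℕ k) a
  (subst (x +ℕ m +ℕ k <ℕ_) (ℕP.+-comm (x +ℕ m) a) (ℕP.+-monoʳ-< (x +ℕ m) k<a))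

coefSeq-diag : ∀ h m x → coefSeq h m zero zero x ≡ 1ℚ
coefSeq-diag h m x =
  trans (cong (λ N → coef (diffPoly h (x +ℕ m) N) zero) (ℕP.+-identityʳ (x +ℕ m)))
        (coef-diffPoly-diag h (x +ℕ m))

degree-step : ∀ a j → suc (suc (a +ℕ j +ℕ j)) ≡ a +ℕ suc j +ℕ suc j
degree-step = solve-∀

coefSeq-polyFun : ∀ h → Positive h → ∀ j a m k → a +ℕ j ≡ k →
  PolyFun (a +ℕ j +ℕ j) j (coefSeq h m k a)
coefSeq-polyFun h h>0 zero zero m _ refl = PolyFun-cong (coefSeq-diag h m) PolyFun-one
coefSeq-polyFun h h>0 zero (suc a) m _ refl =
  PolyFun-antidiff (coefSeq-polyFun h h>0 zero a (suc m) k refl) step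
  where
  k = a +ℕ 0
  step : ∀ x →
    coefSeq h m (suc k) (suc a) (suc x) ≡ coefSeq h m (suc k) (suc a) x + coefSeq h (suc m) k a x
  step x = begin
    coefSeq h m (suc k) (suc a) (suc x)
      ≡⟨ coefSeq-suc-suc h m k a x ⟩
    f + (g + κ * coefSeq h (suc m) k (suc a) x)
      ≡⟨ cong (λ z → f + (g + κ * z)) (coefSeq-vanish h (suc m) k (suc a) x k<1+a) ⟩
    f + (g + κ * 0ℚ)
      ≡⟨ cong (λ z → f + z) (solve 2 (λ g κ → g :+ κ :* con 0ℚ := g) refl g κ) ⟩
    f + g
      ∎
    where
    open ≡-Reasoning
    f = coefSeq h m (suc k) (suc a) x
    g = coefSeq h (suc m) k a x
    κ = - (ℕtoℚ (suc x +ℕ m) * h)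
    k<1+a : k <ℕ suc a
    k<1+a = s≤s (ℕP.≤-reflexive (ℕP.+-identityʳ a))
coefSeq-polyFun h h>0 (suc j) zero m _ refl =
  subst (λ d → PolyFun d (suc j) (coefSeq h m (suc j) zero)) (degree-step 0 j)
    (PolyFun-antidiff (PolyFun-linear h h>0 m (coefSeq-polyFun h h>0 j zero (suc m) j refl))
                      (coefSeq-suc-zero h m j))
coefSeq-polyFun h h>0 (suc j) (suc a) m _ refl =
  PolyFun-antidiff (PolyFun-+ (coefSeq-polyFun h h>0 (suc j) a (suc m) k refl) linearTerm)
                   (coefSeq-suc-suc h m k a)
  where
  k = a +ℕ suc j
  g : ℕ → ℚ
  g x = - (ℕtoℚ (suc x +ℕ m) * h) * coefSeq h (suc m) k (suc a) x
  linearTerm : PolyFun (a +ℕ suc j +ℕ suc j) (suc j) g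
  linearTerm = subst (λ d → PolyFun d (suc j) g) (degree-step a j)
    (PolyFun-linear h h>0 m (coefSeq-polyFun h h>0 j (suc a) (suc m) k (sym (ℕP.+-suc a j))))

+≤⇒<∸ : ∀ {a m p} → a +ℕ m ≤ℕ p → a <ℕ suc p ∸ m
+≤⇒<∸ {a} a+m≤p = ℕP.m+n≤o⇒m≤o∸n (suc a) (s≤s a+m≤p)

<∸⇒+≤ : ∀ {a m p} → a <ℕ suc p ∸ m → a +ℕ m ≤ℕ p
<∸⇒+≤ {a} {m} {p} a<1+p∸m with a +ℕ m ≤? p
... | yes a+m≤p = a+m≤p
... | no  a+m≰p = contradiction a<1+p∸m
  (ℕP.≤⇒≯ (ℕP.m≤n+o⇒m∸n≤o (suc p) m
             (subst (suc p ≤ℕ_) (ℕP.+-comm a m) (ℕP.≰⇒> a+m≰p))))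

∸≤⇒< : ∀ {a m p} → suc p ∸ m ≤ℕ a → p <ℕ a +ℕ m
∸≤⇒< 1+p∸m≤a = ℕP.≰⇒> (λ a+m≤p → ℕP.≤⇒≯ 1+p∸m≤a (+≤⇒<∸ a+m≤p))

+≤⇒decompose : ∀ a m p → a +ℕ m ≤ℕ p → p ≡ p ∸ m ∸ a +ℕ a +ℕ m
+≤⇒decompose a m p a+m≤p =
  trans (sym (ℕP.m∸n+n≡m (ℕP.≤-trans (ℕP.m≤n+m m a) a+m≤p)))
        (cong (_+ℕ m) (sym (ℕP.m∸n+n≡m (ℕP.m+n≤o⇒m≤o∸n a a+m≤p))))

degree-eq : ∀ a m p → a +ℕ m ≤ℕ p →
  a +ℕ (p ∸ m ∸ a) +ℕ (p ∸ m ∸ a) ≡ 2 *ℕ p ∸ a ∸ 2 *ℕ m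
degree-eq a m p a+m≤p =
  trans (sym (cancel (p ∸ m ∸ a)))
        (cong (λ p → 2 *ℕ p ∸ a ∸ 2 *ℕ m) (sym (+≤⇒decompose a m p a+m≤p)))
  where
  expand : ∀ a j m → 2 *ℕ (j +ℕ a +ℕ m) ≡ a +ℕ (a +ℕ j +ℕ j +ℕ 2 *ℕ m)
  expand = solve-∀
  cancel : ∀ j → 2 *ℕ (j +ℕ a +ℕ m) ∸ a ∸ 2 *ℕ m ≡ a +ℕ j +ℕ j
  cancel j =
    trans (cong (λ n → n ∸ a ∸ 2 *ℕ m) (expand a j m))
      (trans (cong (_∸ 2 *ℕ m) (ℕP.m+n∸m≡n a (a +ℕ j +ℕ j +ℕ 2 *ℕ m)))
             (ℕP.m+n∸n≡m (a +ℕ j +ℕ j) (2 *ℕ m)))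

exponent-eq : ∀ a m p x → a +ℕ m ≤ℕ p → x +ℕ m +ℕ (a +ℕ (p ∸ m ∸ a)) ≡ p +ℕ x
exponent-eq a m p x a+m≤p =
  trans (reorder x m a (p ∸ m ∸ a)) (cong (_+ℕ x) (sym (+≤⇒decompose a m p a+m≤p)))
  where
  reorder : ∀ x m a j → x +ℕ m +ℕ (a +ℕ j) ≡ j +ℕ a +ℕ m +ℕ x
  reorder = solve-∀

normDiff-expansion : ∀ q .{{_ : NonZero q}} p m x l (f : ℕ → ℚ) →
  (∀ a → a +ℕ m ≤ℕ p → f a ≡ coef (diffPoly (ℕtoℚ q) (x +ℕ m) (p +ℕ x)) a) →
  normDiff q p m x l ≡ sumL (map (λ a → f a * pow l a) (upTo (suc p ∸ m)))
normDiff-expansion q p m x l f agree = begin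
  normDiff q p m x l                                  ≡⟨ evalP-diffPoly q (x +ℕ m) (p +ℕ x) l ⟩
  evalP D l                                           ≡⟨ evalP-sum (suc p ∸ m) D f l agree′ vanish ⟩
  sumL (applyUpTo (λ a → f a * pow l a) (suc p ∸ m))  ≡⟨ cong sumL (map-upTo _ (suc p ∸ m)) ⟨
  sumL (map (λ a → f a * pow l a) (upTo (suc p ∸ m))) ∎
  where
  open ≡-Reasoning
  D = diffPoly (ℕtoℚ q) (x +ℕ m) (p +ℕ x)
  agree′ : ∀ a → a <ℕ suc p ∸ m → f a ≡ coef D a
  agree′ a a<1+p∸m = agree a (<∸⇒+≤ a<1+p∸m)
  rearrange : ∀ a m x → a +ℕ m +ℕ x ≡ a +ℕ (x +ℕ m)
  rearrange = solve-∀
  vanish : ∀ a → suc p ∸ m ≤ℕ a → coef D a ≡ 0ℚ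
  vanish a 1+p∸m≤a = coef-diffPoly-vanish (ℕtoℚ q) (x +ℕ m) (p +ℕ x) a
    (subst (p +ℕ x <ℕ_) (rearrange a m x) (ℕP.+-monoˡ-< x (∸≤⇒< 1+p∸m≤a)))

lemma4p5 : (q : ℕ) → .{{_ : NonZero q}} → (p m : ℕ) →
  Σ (ℕ → List ℚ) λ c →
    ((a : ℕ) → a +ℕ m ≤ℕ p → HasDegree (c a) (2 *ℕ p ∸ a ∸ 2 *ℕ m))
    × ((x : ℕ) (l : ℚ) →
        normDiff q p m x l
          ≡ sumL (map (λ a → evalP (c a) (ℕtoℚ x) * pow l a) (upTo (suc p ∸ m))))
lemma4p5 q p m = c , degree , λ x l → normDiff-expansion q p m x l _ (agree x)
  where
  Q = ℕtoℚ q
  polynomial : ∀ a → Σ (List ℚ) λ P →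
    HasDegree P (a +ℕ (p ∸ m ∸ a) +ℕ (p ∸ m ∸ a))
    × (∀ x → coefSeq Q m (a +ℕ (p ∸ m ∸ a)) a x ≡ evalP P (ℕtoℚ x))
  polynomial a = PolyFun⇒polynomial (coefSeq-polyFun Q (ℕtoℚ-positive q) (p ∸ m ∸ a) a m _ refl)
  c : ℕ → List ℚ
  c a = proj₁ (polynomial a)
  degree : ∀ a → a +ℕ m ≤ℕ p → HasDegree (c a) (2 *ℕ p ∸ a ∸ 2 *ℕ m)
  degree a a+m≤p = subst (HasDegree (c a)) (degree-eq a m p a+m≤p) (proj₁ (proj₂ (polynomial a)))
  agree : ∀ x a → a +ℕ m ≤ℕ p → evalP (c a) (ℕtoℚ x) ≡ coef (diffPoly Q (x +ℕ m) (p +ℕ x)) a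
  agree x a a+m≤p = trans (sym (proj₂ (proj₂ (polynomial a)) x))
    (cong (λ N → coef (diffPoly Q (x +ℕ m) N) a) (exponent-eq a m p x a+m≤p))
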